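{- Let $m\ge 4$ be an integer. Then there exist infinitely many pairs of positive integers $(N,d)$ such that each of $N,N+d,\ldots,N+(m-1)d$ is squarefull and $$d\ll N^{\frac{2m-4}{2m-3}}(\log N)^{\frac{ -2}{2m-3}},$$ where the implied constant depends only on $m$.
   Context: A positive integer is squarefull if every prime dividing it divides it at least to the second power. -}

module Defs where

open import Data.Nat using (ℕ; _*_; _<_)
open import Data.Nat.Divisibility using (_∣_)
open import Data.Nat.Primality using (Prime)

Squarefull : ℕ → Set
Squarefull n = (0 < n) × (∀ p → Prime p → p ∣ n → p * p ∣ n)
  where open import Data.Product using (_×_)

module Submission where

-- Let X + Y√2 = (3 + 2√2)^(2^j), so that X² = 2Y² + 1, and 2^(j+1) ∣ Y, say Y = 2^(j+1) Z.
-- For P = Y (4X + 6Y) one has P + 1 = (X + 2Y)² and P + 2 = 2 (X + Y)², while P = 2^(j+1) r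
-- with r = Z (4X + 6Y). Put Q = (P + 3)(P + 4)⋯(P + m − 1), S = 2 r Q, d = S² and N = S² P:
-- then N + i d = S² (P + i), and in each term the part of P + i that is not a square only has
-- prime factors dividing S, so every term is squarefull.
-- As for size, S = 2 P Q / 2^(j+1) ≤ P^(m−2) / 2^j up to a constant, while log N = O(2^j)
-- because X + 2Y ≤ 2^(2^(j+2)); the factor 2^(j+1) saved in S is what produces the power of log N.

open import Defs
open import Data.Nat using (ℕ; zero; suc; _+_; _*_; _∸_; _^_; _<_; _≤_; s≤s; z<s; >-nonZero; nonTrivial⇒≢1)
open import Data.Nat.Properties
open import Data.Nat.Divisibility using (_∣_; ∣-trans; ∣1⇒≡1; *-pres-∣; m∣m*n; n∣m*n; n∣m*n*o; ∣m⇒∣m*n; 1∣_)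
open import Data.Nat.Primality using (Prime; euclidsLemma; prime⇒nonTrivial)
open import Data.Nat.Logarithm using (⌊log₂_⌋; ⌊log₂⌋-mono-≤; ⌊log₂[2^n]⌋≡n)
open import Data.Nat.Tactic.RingSolver using (solve-∀)
open import Algebra.Properties.CommutativeSemigroup *-commutativeSemigroup using (interchange; x∙yz≈y∙xz)
open import Data.Fin using (Fin; toℕ)
open import Data.Fin.Properties using (toℕ<n)
open import Data.Product using (Σ; _×_; _,_)
open import Data.Sum using (inj₁; inj₂; [_,_]′)
open import Function using (id)
open import Relation.Nullary using (contradiction)
open import Relation.Binary.PropositionalEquality using (_≡_; refl; sym; trans; cong; subst; subst₂; module ≡-Reasoning)

PrimeFactorsDivide : ℕ → ℕ → Set
PrimeFactorsDivide b A = ∀ p → Prime p → p ∣ b → p ∣ A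

primeFactorsDivide-refl : ∀ {A} → PrimeFactorsDivide A A
primeFactorsDivide-refl _ _ = id

∣⇒primeFactorsDivide : ∀ {b A} → b ∣ A → PrimeFactorsDivide b A
∣⇒primeFactorsDivide b∣A _ _ p∣b = ∣-trans p∣b b∣A

primeFactorsDivide-* : ∀ {a b A} →
  PrimeFactorsDivide a A → PrimeFactorsDivide b A → PrimeFactorsDivide (a * b) A
primeFactorsDivide-* {a} {b} ha hb p pp p∣ab = [ ha p pp , hb p pp ]′ (euclidsLemma a b pp p∣ab)

primeFactorsDivide-^ : ∀ {a A} n → PrimeFactorsDivide a A → PrimeFactorsDivide (a ^ n) A
primeFactorsDivide-^ zero    _  _ pp p∣1 = contradiction (∣1⇒≡1 p∣1) (nonTrivial⇒≢1 {{prime⇒nonTrivial pp}})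
primeFactorsDivide-^ (suc n) ha = primeFactorsDivide-* ha (primeFactorsDivide-^ n ha)

squarefull-square* : ∀ {A b} → 0 < A → 0 < b → PrimeFactorsDivide b A → Squarefull (A * A * b)
squarefull-square* {A} {b} 0<A 0<b hb = *-mono-≤ (*-mono-≤ 0<A 0<A) 0<b , λ p pp p∣AAb →
  let p∣A = primeFactorsDivide-* (primeFactorsDivide-* primeFactorsDivide-refl primeFactorsDivide-refl) hb
              p pp p∣AAb
  in ∣-trans (*-pres-∣ p∣A p∣A) (m∣m*n b)

n<2^n : ∀ n → n < 2 ^ n
n<2^n zero    = z<s
n<2^n (suc n) = +-mono-≤ (m^n>0 2 n) (≤-trans (n<2^n n) (m≤m+n (2 ^ n) 0))

^-distrib-* : ∀ a b n → (a * b) ^ n ≡ a ^ n * b ^ n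
^-distrib-* a b zero    = refl
^-distrib-* a b (suc n) = trans (cong (a * b *_) (^-distrib-* a b n)) (interchange a b (a ^ n) (b ^ n))

^-bound-* : ∀ W i k {a b} → a ≤ W ^ i → b ≤ W ^ k → a * b ≤ W ^ (i + k)
^-bound-* W i k ha hb = ≤-trans (*-mono-≤ ha hb) (≤-reflexive (sym (^-distribˡ-+-* W i k)))

^-bound-^ : ∀ W i n {a} → a ≤ W ^ i → a ^ n ≤ W ^ (i * n)
^-bound-^ W i n ha = ≤-trans (^-monoˡ-≤ n ha) (≤-reflexive (^-*-assoc W i n))

^-suc-gain : ∀ {s L C P} E → s * (L * L) ≤ C * P ^ E → s ^ suc E * L ^ 2 ≤ C * (s * P) ^ E
^-suc-gain {s} {L} {C} {P} E h = begin
  s ^ suc E * L ^ 2       ≡⟨ regroup s (s ^ E) L ⟩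
  s ^ E * (s * (L * L))   ≤⟨ *-monoʳ-≤ (s ^ E) h ⟩
  s ^ E * (C * P ^ E)     ≡⟨ x∙yz≈y∙xz (s ^ E) C (P ^ E) ⟩
  C * (s ^ E * P ^ E)     ≡⟨ cong (C *_) (sym (^-distrib-* s P E)) ⟩
  C * (s * P) ^ E         ∎
  where
  open ≤-Reasoning
  regroup : ∀ s sᴱ L → s * sᴱ * (L * (L * 1)) ≡ sᴱ * (s * (L * L))
  regroup = solve-∀

risingFactorial : ℕ → ℕ → ℕ
risingFactorial a zero    = 1
risingFactorial a (suc n) = risingFactorial a n * (a + n)

risingFactorial-pos : ∀ {a} n → 0 < a → 0 < risingFactorial a n
risingFactorial-pos zero        _   = z<s
risingFactorial-pos {a} (suc n) 0<a = *-mono-≤ (risingFactorial-pos n 0<a) (≤-trans 0<a (m≤m+n a n))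

a+t∣risingFactorial : ∀ a {n t} → t < n → a + t ∣ risingFactorial a n
a+t∣risingFactorial a {suc n} t<1+n with m<1+n⇒m<n∨m≡n t<1+n
... | inj₁ t<n  = ∣m⇒∣m*n (a + n) (a+t∣risingFactorial a t<n)
... | inj₂ refl = n∣m*n (risingFactorial a n)

risingFactorial-≤ : ∀ {a b} n → a + n ≤ b → risingFactorial a n ≤ b ^ n
risingFactorial-≤         zero    _ = ≤-refl
risingFactorial-≤ {a} {b} (suc n) h =
  ≤-trans (*-mono-≤ (risingFactorial-≤ n a+n≤b) a+n≤b) (≤-reflexive (*-comm (b ^ n) b))
  where
  a+n≤b : a + n ≤ b
  a+n≤b = ≤-trans (+-monoʳ-≤ a (n≤1+n n)) h

mutual
  pellX : ℕ → ℕ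
  pellX zero    = 3
  pellX (suc j) = pellX j * pellX j + 2 * (pellY j * pellY j)

  pellY : ℕ → ℕ
  pellY zero    = 2
  pellY (suc j) = 2 * (pellX j * pellY j)

pellZ : ℕ → ℕ
pellZ zero    = 1
pellZ (suc j) = pellX j * pellZ j

pellY≡2^[1+j]*pellZ : ∀ j → pellY j ≡ 2 ^ suc j * pellZ j
pellY≡2^[1+j]*pellZ zero    = refl
pellY≡2^[1+j]*pellZ (suc j) =
  trans (cong (λ y → 2 * (pellX j * y)) (pellY≡2^[1+j]*pellZ j)) (regroup (pellX j) (2 ^ suc j) (pellZ j))
  where
  regroup : ∀ x p z → 2 * (x * (p * z)) ≡ 2 * p * (x * z)
  regroup = solve-∀

pell-square : ∀ a b → a * a ≡ 2 * (b * b) + 1 →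
  (a * a + 2 * (b * b)) * (a * a + 2 * (b * b)) ≡ 2 * (2 * (a * b) * (2 * (a * b))) + 1
pell-square a b pell = begin
  (a * a + 2 * (b * b)) * (a * a + 2 * (b * b))
    ≡⟨ cong (λ s → (s + 2 * (b * b)) * (s + 2 * (b * b))) pell ⟩
  (2 * (b * b) + 1 + 2 * (b * b)) * (2 * (b * b) + 1 + 2 * (b * b))
    ≡⟨ expand (b * b) ⟩
  8 * ((2 * (b * b) + 1) * (b * b)) + 1
    ≡⟨ cong (λ s → 8 * (s * (b * b)) + 1) (sym pell) ⟩
  8 * (a * a * (b * b)) + 1
    ≡⟨ regroup a b ⟩
  2 * (2 * (a * b) * (2 * (a * b))) + 1
    ∎
  where
  open ≡-Reasoning
  expand : ∀ v → (2 * v + 1 + 2 * v) * (2 * v + 1 + 2 * v) ≡ 8 * ((2 * v + 1) * v) + 1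
  expand = solve-∀
  regroup : ∀ a b → 8 * (a * a * (b * b)) + 1 ≡ 2 * (2 * (a * b) * (2 * (a * b))) + 1
  regroup = solve-∀

pell : ∀ j → pellX j * pellX j ≡ 2 * (pellY j * pellY j) + 1
pell zero    = refl
pell (suc j) = pell-square (pellX j) (pellY j) (pell j)

pell⇒b[4a+6b]+1≡[a+2b]² : ∀ a b → a * a ≡ 2 * (b * b) + 1 →
  b * (4 * a + 6 * b) + 1 ≡ (a + 2 * b) * (a + 2 * b)
pell⇒b[4a+6b]+1≡[a+2b]² a b pell = begin
  b * (4 * a + 6 * b) + 1                     ≡⟨ lhs a b ⟩
  2 * (b * b) + 1 + 4 * (a * b) + 4 * (b * b) ≡⟨ cong (λ s → s + 4 * (a * b) + 4 * (b * b)) (sym pell) ⟩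
  a * a + 4 * (a * b) + 4 * (b * b)           ≡⟨ rhs a b ⟩
  (a + 2 * b) * (a + 2 * b)                   ∎
  where
  open ≡-Reasoning
  lhs : ∀ a b → b * (4 * a + 6 * b) + 1 ≡ 2 * (b * b) + 1 + 4 * (a * b) + 4 * (b * b)
  lhs = solve-∀
  rhs : ∀ a b → a * a + 4 * (a * b) + 4 * (b * b) ≡ (a + 2 * b) * (a + 2 * b)
  rhs = solve-∀

pell⇒b[4a+6b]+2≡2[a+b]² : ∀ a b → a * a ≡ 2 * (b * b) + 1 →
  b * (4 * a + 6 * b) + 2 ≡ 2 * ((a + b) * (a + b))
pell⇒b[4a+6b]+2≡2[a+b]² a b pell = begin
  b * (4 * a + 6 * b) + 2                           ≡⟨ lhs a b ⟩
  2 * (2 * (b * b) + 1) + 4 * (a * b) + 2 * (b * b) ≡⟨ cong (λ s → 2 * s + 4 * (a * b) + 2 * (b * b)) (sym pell) ⟩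
  2 * (a * a) + 4 * (a * b) + 2 * (b * b)           ≡⟨ rhs a b ⟩
  2 * ((a + b) * (a + b))                           ∎
  where
  open ≡-Reasoning
  lhs : ∀ a b → b * (4 * a + 6 * b) + 2 ≡ 2 * (2 * (b * b) + 1) + 4 * (a * b) + 2 * (b * b)
  lhs = solve-∀
  rhs : ∀ a b → 2 * (a * a) + 4 * (a * b) + 2 * (b * b) ≡ 2 * ((a + b) * (a + b))
  rhs = solve-∀

pellX-pos : ∀ j → 0 < pellX j
pellX-pos zero    = z<s
pellX-pos (suc j) = ≤-trans (*-mono-≤ (pellX-pos j) (pellX-pos j)) (m≤m+n _ _)

pellZ-pos : ∀ j → 0 < pellZ j
pellZ-pos zero    = z<s
pellZ-pos (suc j) = *-mono-≤ (pellX-pos j) (pellZ-pos j)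

pell-bound : ∀ j → pellX j + 2 * pellY j ≤ 2 ^ (2 * 2 ^ suc j)
pell-bound zero    = m≤m+n 7 9
pell-bound (suc j) = begin
  pellX (suc j) + 2 * pellY (suc j)   ≤⟨ square-step (pellX j) (pellY j) ⟩
  (pellX j + 2 * pellY j) * (pellX j + 2 * pellY j)
                                      ≤⟨ *-mono-≤ (pell-bound j) (pell-bound j) ⟩
  2 ^ e * 2 ^ e                       ≡⟨ sym (^-distribˡ-+-* 2 e e) ⟩
  2 ^ (e + e)                         ≡⟨ cong (2 ^_) (double (2 ^ suc j)) ⟩
  2 ^ (2 * 2 ^ suc (suc j))           ∎
  where
  open ≤-Reasoning
  e : ℕ
  e = 2 * 2 ^ suc j
  square-step : ∀ a b → a * a + 2 * (b * b) + 2 * (2 * (a * b)) ≤ (a + 2 * b) * (a + 2 * b)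
  square-step a b = subst (a * a + 2 * (b * b) + 2 * (2 * (a * b)) ≤_) (complete a b) (m≤m+n _ (2 * (b * b)))
    where
    complete : ∀ a b → a * a + 2 * (b * b) + 2 * (2 * (a * b)) + 2 * (b * b) ≡ (a + 2 * b) * (a + 2 * b)
    complete = solve-∀
  double : ∀ u → 2 * u + 2 * u ≡ 2 * (2 * u)
  double = solve-∀

module Progression (n : ℕ) where

  c : ℕ
  c = 4 + n

  e : ℕ
  e = 3 + (c + 2) * n

  t : ℕ
  t = e + e + 2

  K : ℕ
  K = 2 * t

  A : ℕ
  A = 2 * K * c ^ n

  C : ℕ
  C = A * A

  E : ℕ
  E = suc n + suc n

  module Witness (j : ℕ) where

    X Y M r P Q S d N x y W : ℕ
    X = pellX j
    Y = pellY j
    M = 2 ^ suc j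
    r = pellZ j * (4 * X + 6 * Y)
    P = M * r
    Q = risingFactorial (P + 3) n
    S = 2 * r * Q
    d = S * S
    N = d * P
    x = X + 2 * Y
    y = X + Y
    W = 2 ^ (2 * M)

    P≡Y[4X+6Y] : P ≡ Y * (4 * X + 6 * Y)
    P≡Y[4X+6Y] = trans (sym (*-assoc M (pellZ j) _)) (cong (_* (4 * X + 6 * Y)) (sym (pellY≡2^[1+j]*pellZ j)))

    P+1≡x² : P + 1 ≡ x * x
    P+1≡x² = trans (cong (_+ 1) P≡Y[4X+6Y]) (pell⇒b[4a+6b]+1≡[a+2b]² X Y (pell j))

    P+2≡2y² : P + 2 ≡ 2 * (y * y)
    P+2≡2y² = trans (cong (_+ 2) P≡Y[4X+6Y]) (pell⇒b[4a+6b]+2≡2[a+b]² X Y (pell j))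

    0<M : 0 < M
    0<M = m^n>0 2 (suc j)

    0<x : 0 < x
    0<x = ≤-trans (pellX-pos j) (m≤m+n X _)

    0<y : 0 < y
    0<y = ≤-trans (pellX-pos j) (m≤m+n X Y)

    0<r : 0 < r
    0<r = *-mono-≤ (pellZ-pos j) (≤-trans (pellX-pos j) (≤-trans (m≤n*m X 4) (m≤m+n _ _)))

    0<P : 0 < P
    0<P = *-mono-≤ 0<M 0<r

    0<P+3 : 0 < P + 3
    0<P+3 = ≤-trans z<s (m≤n+m 3 P)

    0<Q : 0 < Q
    0<Q = risingFactorial-pos n 0<P+3

    0<S : 0 < S
    0<S = *-mono-≤ (*-mono-≤ {1} {2} z<s 0<r) 0<Q

    0<d : 0 < d
    0<d = *-mono-≤ 0<S 0<S

    S*M≡2PQ : S * M ≡ 2 * P * Q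
    S*M≡2PQ = regroup r Q M
      where
      regroup : ∀ r Q M → 2 * r * Q * M ≡ 2 * (M * r) * Q
      regroup = solve-∀

    2∣S : 2 ∣ S
    2∣S = ∣m⇒∣m*n Q (m∣m*n r)

    r∣S : r ∣ S
    r∣S = n∣m*n*o 2 Q

    primeFactorsDivide-P-S : PrimeFactorsDivide P S
    primeFactorsDivide-P-S = primeFactorsDivide-* {M} {r}
      (primeFactorsDivide-^ (suc j) (∣⇒primeFactorsDivide 2∣S)) (∣⇒primeFactorsDivide r∣S)

    term-squarefull : ∀ i {a b} → P + i ≡ a * a * b → 0 < a → 0 < b → PrimeFactorsDivide b S →
      Squarefull (N + i * d)
    term-squarefull i {a} {b} P+i≡a²b 0<a 0<b hb =
      subst Squarefull (sym N+id≡[Sa]²b)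
        (squarefull-square* (*-mono-≤ 0<S 0<a) 0<b (λ p pp p∣b → ∣m⇒∣m*n a (hb p pp p∣b)))
      where
      open ≡-Reasoning
      N+id≡[Sa]²b : N + i * d ≡ S * a * (S * a) * b
      N+id≡[Sa]²b = begin
        S * S * P + i * (S * S) ≡⟨ factor S P i ⟩
        S * S * (P + i)         ≡⟨ cong (S * S *_) P+i≡a²b ⟩
        S * S * (a * a * b)     ≡⟨ regroup S a b ⟩
        S * a * (S * a) * b     ∎
        where
        factor : ∀ S P i → S * S * P + i * (S * S) ≡ S * S * (P + i)
        factor = solve-∀
        regroup : ∀ S a b → S * S * (a * a * b) ≡ S * a * (S * a) * b
        regroup = solve-∀

    squarefull-terms : (i : Fin (3 + n)) → Squarefull (N + toℕ i * d)
    squarefull-terms Fin.zero =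
      term-squarefull 0 {1} (trans (+-identityʳ P) (sym (*-identityˡ P))) z<s 0<P primeFactorsDivide-P-S
    squarefull-terms (Fin.suc Fin.zero) =
      term-squarefull 1 (trans P+1≡x² (sym (*-identityʳ (x * x)))) 0<x z<s (∣⇒primeFactorsDivide (1∣ S))
    squarefull-terms (Fin.suc (Fin.suc Fin.zero)) =
      term-squarefull 2 (trans P+2≡2y² (*-comm 2 (y * y))) 0<y z<s (∣⇒primeFactorsDivide 2∣S)
    squarefull-terms (Fin.suc (Fin.suc (Fin.suc u))) =
      term-squarefull (3 + toℕ u) {1} (trans (sym (+-assoc P 3 (toℕ u))) (sym (*-identityˡ _)))
        z<s (≤-trans 0<P+3 (m≤m+n (P + 3) (toℕ u)))
        (∣⇒primeFactorsDivide (∣-trans (a+t∣risingFactorial (P + 3) (toℕ<n u)) (n∣m*n (2 * r))))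

    j<N : j < N
    j<N = begin-strict
      j  <⟨ <-trans (n<1+n j) (n<2^n (suc j)) ⟩
      M  ≤⟨ m≤m*n M r {{>-nonZero 0<r}} ⟩
      P  ≤⟨ m≤n*m P d {{>-nonZero 0<d}} ⟩
      N  ∎
      where open ≤-Reasoning

    Q≤[cP]^n : Q ≤ (c * P) ^ n
    Q≤[cP]^n = risingFactorial-≤ n (begin
      P + 3 + n      ≡⟨ +-assoc P 3 n ⟩
      P + (3 + n)    ≤⟨ +-monoʳ-≤ P (m≤m*n (3 + n) P {{>-nonZero 0<P}}) ⟩
      P + (3 + n) * P ∎)
      where open ≤-Reasoning

    2≤W : 2 ≤ W
    2≤W = ^-monoʳ-≤ 2 (≤-trans 0<M (m≤n*m M 2))

    P≤W^2 : P ≤ W ^ 2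
    P≤W^2 = begin
      P        ≤⟨ m≤m+n P 1 ⟩
      P + 1    ≡⟨ P+1≡x² ⟩
      x * x    ≤⟨ *-mono-≤ (pell-bound j) (pell-bound j) ⟩
      W * W    ≡⟨ cong (W *_) (sym (*-identityʳ W)) ⟩
      W ^ 2    ∎
      where open ≤-Reasoning

    N≤W^t : N ≤ W ^ t
    N≤W^t = ^-bound-* W (e + e) 2 (^-bound-* W e e S≤W^e S≤W^e) P≤W^2
      where
      c≤W^c : c ≤ W ^ c
      c≤W^c = ≤-trans (<⇒≤ (n<2^n c)) (^-monoˡ-≤ c 2≤W)
      Q≤W^[[c+2]n] : Q ≤ W ^ ((c + 2) * n)
      Q≤W^[[c+2]n] = ≤-trans Q≤[cP]^n (^-bound-^ W (c + 2) n (^-bound-* W c 2 c≤W^c P≤W^2))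
      S≤2PQ : S ≤ 2 * P * Q
      S≤2PQ = ≤-trans (m≤m*n S M {{>-nonZero 0<M}}) (≤-reflexive S*M≡2PQ)
      S≤W^e : S ≤ W ^ e
      S≤W^e = ≤-trans S≤2PQ
        (^-bound-* W 3 ((c + 2) * n) (^-bound-* W 1 2 (≤-trans 2≤W (m≤m*n W 1)) P≤W^2) Q≤W^[[c+2]n])

    log₂N≤K*M : ⌊log₂ N ⌋ ≤ K * M
    log₂N≤K*M = begin
      ⌊log₂ N ⌋              ≤⟨ ⌊log₂⌋-mono-≤ N≤W^t ⟩
      ⌊log₂ W ^ t ⌋          ≡⟨ cong ⌊log₂_⌋ (^-*-assoc 2 (2 * M) t) ⟩
      ⌊log₂ 2 ^ (2 * M * t) ⌋ ≡⟨ ⌊log₂[2^n]⌋≡n (2 * M * t) ⟩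
      2 * M * t              ≡⟨ regroup M t ⟩
      K * M                  ∎
      where
      open ≤-Reasoning
      regroup : ∀ M t → 2 * M * t ≡ 2 * t * M
      regroup = solve-∀

    -- The log costs K·M, and M is exactly the factor by which S falls short of 2PQ.
    S*log₂N≤A*P^[1+n] : S * ⌊log₂ N ⌋ ≤ A * P ^ suc n
    S*log₂N≤A*P^[1+n] = begin
      S * ⌊log₂ N ⌋             ≤⟨ *-monoʳ-≤ S log₂N≤K*M ⟩
      S * (K * M)               ≡⟨ x∙yz≈y∙xz S K M ⟩
      K * (S * M)               ≡⟨ cong (K *_) S*M≡2PQ ⟩
      K * (2 * P * Q)           ≤⟨ *-monoʳ-≤ K (*-monoʳ-≤ (2 * P) Q≤cⁿPⁿ) ⟩
      K * (2 * P * (c ^ n * P ^ n)) ≡⟨ regroup K P (c ^ n) (P ^ n) ⟩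
      A * P ^ suc n             ∎
      where
      open ≤-Reasoning
      Q≤cⁿPⁿ : Q ≤ c ^ n * P ^ n
      Q≤cⁿPⁿ = ≤-trans Q≤[cP]^n (≤-reflexive (^-distrib-* c P n))
      regroup : ∀ K P cⁿ Pⁿ → K * (2 * P * (cⁿ * Pⁿ)) ≡ 2 * K * cⁿ * (P * Pⁿ)
      regroup = solve-∀

    d^[1+E]*log₂N²≤C*N^E : d ^ suc E * ⌊log₂ N ⌋ ^ 2 ≤ C * N ^ E
    d^[1+E]*log₂N²≤C*N^E = ^-suc-gain {d} {⌊log₂ N ⌋} {C} {P} E (begin
      S * S * (L * L)                   ≡⟨ interchange S S L L ⟩
      S * L * (S * L)                   ≤⟨ *-mono-≤ S*log₂N≤A*P^[1+n] S*log₂N≤A*P^[1+n] ⟩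
      A * P ^ suc n * (A * P ^ suc n)   ≡⟨ interchange A (P ^ suc n) A (P ^ suc n) ⟩
      A * A * (P ^ suc n * P ^ suc n)   ≡⟨ cong (C *_) (sym (^-distribˡ-+-* P (suc n) (suc n))) ⟩
      C * P ^ E                         ∎)
      where
      open ≤-Reasoning
      L : ℕ
      L = ⌊log₂ N ⌋

2*[3+n]∸3≡1+[1+n]+[1+n] : ∀ n → 2 * (3 + n) ∸ 3 ≡ suc (suc n + suc n)
2*[3+n]∸3≡1+[1+n]+[1+n] n = trans (cong (_∸ 3) (split n)) (m+n∸n≡m (suc (suc n + suc n)) 3)
  where
  split : ∀ n → 2 * (3 + n) ≡ suc (suc n + suc n) + 3
  split = solve-∀

2*[3+n]∸4≡[1+n]+[1+n] : ∀ n → 2 * (3 + n) ∸ 4 ≡ suc n + suc n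
2*[3+n]∸4≡[1+n]+[1+n] n = trans (cong (_∸ 4) (split n)) (m+n∸n≡m (suc n + suc n) 4)
  where
  split : ∀ n → 2 * (3 + n) ≡ suc n + suc n + 4
  split = solve-∀

theorem3 : (m : ℕ) → 4 ≤ m →
    Σ ℕ λ C → (B : ℕ) → Σ ℕ λ N → Σ ℕ λ d →
      (B < N) × (0 < d) ×
      ((i : Fin m) → Squarefull (N + toℕ i * d)) ×
      (d ^ (2 * m ∸ 3) * (⌊log₂ N ⌋ ^ 2) ≤ C * N ^ (2 * m ∸ 4))
theorem3 (suc (suc (suc n))) (s≤s (s≤s (s≤s _))) = C , λ B → let open Witness B in
  N , d , j<N , 0<d , squarefull-terms ,
  subst₂ (λ a b → d ^ a * ⌊log₂ N ⌋ ^ 2 ≤ C * N ^ b)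
    (sym (2*[3+n]∸3≡1+[1+n]+[1+n] n)) (sym (2*[3+n]∸4≡[1+n]+[1+n] n)) d^[1+E]*log₂N²≤C*N^E
  where open Progression n
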